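{- For any integer $m\ge 2$, $\xi(K_2\square K_m)=m$.
   Context: All graphs are finite, simple, connected and undirected; $d_G(u,v)$ is the shortest-path distance. A set $D\subseteq V(G)$ is a distance-equalizer set of $G$ if for any two vertices $x,y\in V(G)\setminus D$ there is $w\in D$ with $d_G(x,w)=d_G(y,w)$. The equidistant dimension $\xi(G)$ is the minimum cardinality of a distance-equalizer set of $G$. $K_m$ is the complete graph on $m$ vertices. The Cartesian product $G\square H$ has vertex set $V(G)\times V(H)$, with $(g,h)\sim(g',h')$ iff either $g=g'$ and $hh'\in E(H)$, or $h=h'$ and $gg'\in E(G)$. -}

module Defs where

open import Data.Nat using (ℕ; zero; suc; _*_; _≤_)
open import Data.Fin using (Fin; remQuot)
open import Data.Fin.Subset using (Subset; _∉_; ∣_∣)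
open import Data.Product using (_×_; Σ-syntax; ∃-syntax; proj₁; proj₂)
open import Data.Sum using (_⊎_)
open import Relation.Binary.PropositionalEquality using (_≡_; _≢_)

record Graph : Set₁ where
  field
    order : ℕ
    Adj   : Fin order → Fin order → Set
open Graph public

Vertex : Graph → Set
Vertex G = Fin (order G)

data Walk (G : Graph) : Vertex G → Vertex G → ℕ → Set where
  nil  : ∀ {x} → Walk G x x 0
  cons : ∀ {x y z k} → Adj G x y → Walk G y z k → Walk G x z (suc k)

Dist : (G : Graph) → Vertex G → Vertex G → ℕ → Set
Dist G x y k = Walk G x y k × (∀ j → Walk G x y j → k ≤ j)

K : ℕ → Graph
K m = record { order = m ; Adj = λ x y → x ≢ y }

-- Cartesian product G □ H; vertex set Fin (|G| * |H|) ≅ Fin |G| × Fin |H| via remQuot.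
_□_ : Graph → Graph → Graph
G □ H = record
  { order = order G * order H
  ; Adj   = λ u v →
      let gu = proj₁ (remQuot {order G} (order H) u) ; hu = proj₂ (remQuot {order G} (order H) u)
          gv = proj₁ (remQuot {order G} (order H) v) ; hv = proj₂ (remQuot {order G} (order H) v)
      in (gu ≡ gv × Adj H hu hv) ⊎ (hu ≡ hv × Adj G gu gv)
  }

IsDistanceEqualizer : (G : Graph) → Subset (order G) → Set
IsDistanceEqualizer G D =
  ∀ x y → x ∉ D → y ∉ D → x ≢ y →
    ∃[ w ] (w Data.Fin.Subset.∈ D × ∃[ k ] (Dist G x w k × Dist G y w k))

EquidistantDimensionIs : Graph → ℕ → Set
EquidistantDimensionIs G k =
  (∃[ D ] (IsDistanceEqualizer G D × ∣ D ∣ ≡ k)) ×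
  (∀ D → IsDistanceEqualizer G D → k ≤ ∣ D ∣)

-- Each rung {(0,i), (1,i)} of K₂ □ K_m is equidistant from no vertex w: the end of the rung
-- in w's layer is w itself or a neighbour of w, whereas the other end is not w and, unless
-- w lies on the rung, not adjacent to w either.  Hence every distance-equalizer set meets all
-- m rungs.  Conversely, (0,0) is adjacent to every vertex outside {(0,0)} ∪ {(1,j) | j ≠ 0},
-- so that set of size m is a distance-equalizer set.
module Submission where

open import Defs
open import Data.Nat using (ℕ; zero; suc; _+_; _∸_; _*_; _≤_; z≤n; s≤s)
open import Data.Nat.Properties using (≤-trans; ≤-reflexive; n≤1+n; +-suc; +-identityʳ; +-monoʳ-≤; n≤0⇒n≡0; module ≤-Reasoning)
open import Data.Fin using (Fin; zero; suc; combine; _↑ˡ_)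
open import Data.Fin.Properties using (_≟_; remQuot-combine; combine-injectiveˡ; combine-surjective)
open import Data.Fin.Subset using (Subset; inside; outside; _∈_; _∉_; _∪_; ⊤; ∁; ⁅_⁆; ∣_∣)
open import Data.Fin.Subset.Properties
  using (_∈?_; x∈p∪q⁺; p⊆q⇒∣p∣≤∣q∣; ∣⊤∣≡n; x∈⁅x⁆; x∈⁅y⁆⇒x≡y; x∉∁p⇒x∈p; ∣⁅x⁆∣≡1; ∣∁p∣≡n∸∣p∣)
open import Data.Vec using ([]; _∷_; _++_; lookup; splitAt)
open import Data.Vec.Properties using ([]=⇒lookup; lookup⇒[]=; lookup-++ˡ; lookup-++ʳ)
open import Data.Product using (_×_; _,_; ∃-syntax; ∃₂)
open import Data.Sum using (_⊎_; inj₁; inj₂)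
open import Function using (_∘_)
open import Relation.Nullary using (¬_; yes; no; contradiction)
open import Relation.Binary.PropositionalEquality
  using (_≡_; _≢_; refl; sym; trans; cong; subst; subst₂; module ≡-Reasoning)

private
  variable
    m n : ℕ

Walk⇒≡ : ∀ {G x y} → Walk G x y 0 → x ≡ y
Walk⇒≡ nil = refl

Walk⇒Adj : ∀ {G x y} → Walk G x y 1 → Adj G x y
Walk⇒Adj (cons x~y nil) = x~y

Walk≤1⇒≡⊎Adj : ∀ {G x y k} → Walk G x y k → k ≤ 1 → x ≡ y ⊎ Adj G x y
Walk≤1⇒≡⊎Adj {k = zero}  p _         = inj₁ (Walk⇒≡ p)
Walk≤1⇒≡⊎Adj {k = suc _} p (s≤s z≤n) = inj₂ (Walk⇒Adj p)

Adj⇒Dist1 : ∀ {G x y} → Adj G x y → x ≢ y → Dist G x y 1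
Adj⇒Dist1 {G} {x} {y} x~y x≢y = cons x~y nil , shortest
  where
  shortest : ∀ j → Walk G x y j → 1 ≤ j
  shortest zero    p = contradiction (Walk⇒≡ p) x≢y
  shortest (suc _) _ = s≤s z≤n

Equidistant : (G : Graph) → Vertex G → Vertex G → Vertex G → Set
Equidistant G x y w = ∃[ k ] (Dist G x w k × Dist G y w k)

equidistant-from-self : ∀ {G x y} → Equidistant G x y x → y ≡ x
equidistant-from-self (k , (_ , shortest) , (y⇝x , _))
  with refl ← n≤0⇒n≡0 (shortest 0 nil) = Walk⇒≡ y⇝x

equidistant-from-neighbour : ∀ {G x y w} → Equidistant G x y w → Adj G x w → y ≡ w ⊎ Adj G y w
equidistant-from-neighbour (k , (_ , shortest) , (y⇝w , _)) x~w =
  Walk≤1⇒≡⊎Adj y⇝w (shortest 1 (cons x~w nil))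

equalizer-meets-unequalizable-pair :
  ∀ {G D x y} → IsDistanceEqualizer G D → x ≢ y → (∀ w → ¬ Equidistant G x y w) → x ∈ D ⊎ y ∈ D
equalizer-meets-unequalizable-pair {D = D} {x} {y} equalizer x≢y unequalizable with x ∈? D | y ∈? D
... | yes x∈D | _       = inj₁ x∈D
... | no _    | yes y∈D = inj₂ y∈D
... | no x∉D  | no y∉D  with w , _ , equidistant ← equalizer x y x∉D y∉D x≢y =
  contradiction equidistant (unequalizable w)

equalizer-of-universal-vertex :
  ∀ {G D w} → w ∈ D → (∀ x → x ∉ D → Adj G x w) → IsDistanceEqualizer G D
equalizer-of-universal-vertex {w = w} w∈D universal x y x∉D y∉D _ =
  w , w∈D , 1 , Adj⇒Dist1 (universal x x∉D) (λ { refl → x∉D w∈D })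
              , Adj⇒Dist1 (universal y y∉D) (λ { refl → y∉D w∈D })

∣p∪q∣≤∣p∣+∣q∣ : (p q : Subset n) → ∣ p ∪ q ∣ ≤ ∣ p ∣ + ∣ q ∣
∣p∪q∣≤∣p∣+∣q∣ []            []            = z≤n
∣p∪q∣≤∣p∣+∣q∣ (inside  ∷ p) (inside  ∷ q) = s≤s (≤-trans (∣p∪q∣≤∣p∣+∣q∣ p q) (+-monoʳ-≤ ∣ p ∣ (n≤1+n _)))
∣p∪q∣≤∣p∣+∣q∣ (inside  ∷ p) (outside ∷ q) = s≤s (∣p∪q∣≤∣p∣+∣q∣ p q)
∣p∪q∣≤∣p∣+∣q∣ (outside ∷ p) (inside  ∷ q) = ≤-trans (s≤s (∣p∪q∣≤∣p∣+∣q∣ p q)) (≤-reflexive (sym (+-suc ∣ p ∣ ∣ q ∣)))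
∣p∪q∣≤∣p∣+∣q∣ (outside ∷ p) (outside ∷ q) = ∣p∪q∣≤∣p∣+∣q∣ p q

covering-pair-size : (p q : Subset n) → (∀ i → i ∈ p ⊎ i ∈ q) → n ≤ ∣ p ∣ + ∣ q ∣
covering-pair-size {n} p q covers = begin
  n             ≡⟨ sym (∣⊤∣≡n n) ⟩
  ∣ ⊤ {n} ∣     ≤⟨ p⊆q⇒∣p∣≤∣q∣ {p = ⊤} {q = p ∪ q} (λ {i} _ → x∈p∪q⁺ (covers i)) ⟩
  ∣ p ∪ q ∣     ≤⟨ ∣p∪q∣≤∣p∣+∣q∣ p q ⟩
  ∣ p ∣ + ∣ q ∣ ∎
  where open ≤-Reasoning

∣p++q∣≡∣p∣+∣q∣ : ∀ {k} (p : Subset n) (q : Subset k) → ∣ p ++ q ∣ ≡ ∣ p ∣ + ∣ q ∣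
∣p++q∣≡∣p∣+∣q∣ []            q = refl
∣p++q∣≡∣p∣+∣q∣ (inside  ∷ p) q = cong suc (∣p++q∣≡∣p∣+∣q∣ p q)
∣p++q∣≡∣p∣+∣q∣ (outside ∷ p) q = ∣p++q∣≡∣p∣+∣q∣ p q

-- layers p q meets layer 0 (the vertices combine 0 i) in p and layer 1 in q.
layers : Subset m → Subset m → Subset (2 * m)
layers p q = p ++ (q ++ [])

layers-surjective : (D : Subset (2 * m)) → ∃₂ λ p q → D ≡ layers p q
layers-surjective {m} D with p , rest , refl ← splitAt m D with q , [] , refl ← splitAt m rest =
  p , q , refl

∣layers∣ : (p q : Subset m) → ∣ layers p q ∣ ≡ ∣ p ∣ + ∣ q ∣
∣layers∣ p q = begin
  ∣ p ++ (q ++ []) ∣  ≡⟨ ∣p++q∣≡∣p∣+∣q∣ p (q ++ []) ⟩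
  ∣ p ∣ + ∣ q ++ [] ∣ ≡⟨ cong (∣ p ∣ +_) (∣p++q∣≡∣p∣+∣q∣ q []) ⟩
  ∣ p ∣ + (∣ q ∣ + 0) ≡⟨ cong (∣ p ∣ +_) (+-identityʳ ∣ q ∣) ⟩
  ∣ p ∣ + ∣ q ∣       ∎
  where open ≡-Reasoning

lookup-layers₀ : (p q : Subset m) (i : Fin m) → lookup (layers p q) (combine {2} zero i) ≡ lookup p i
lookup-layers₀ p q i = lookup-++ˡ p (q ++ []) i

lookup-layers₁ : (p q : Subset m) (i : Fin m) → lookup (layers p q) (combine {2} (suc zero) i) ≡ lookup q i
lookup-layers₁ {m} p q i = trans (lookup-++ʳ p (q ++ []) (i ↑ˡ 0)) (lookup-++ˡ q [] i)

∈-transport : ∀ {k} {p : Subset n} {q : Subset k} {i j} → lookup p i ≡ lookup q j → i ∈ p → j ∈ q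
∈-transport {j = j} eq i∈p = lookup⇒[]= j _ (trans (sym eq) ([]=⇒lookup i∈p))

module _ {G H : Graph} {a b : Vertex G} {i j : Vertex H} where

  private
    Adj′ : Vertex G × Vertex H → Vertex G × Vertex H → Set
    Adj′ (a , i) (b , j) = (a ≡ b × Adj H i j) ⊎ (i ≡ j × Adj G a b)

  □-Adj⁺ : (a ≡ b × Adj H i j) ⊎ (i ≡ j × Adj G a b) → Adj (G □ H) (combine a i) (combine b j)
  □-Adj⁺ = subst₂ Adj′ (sym (remQuot-combine a i)) (sym (remQuot-combine b j))

  □-Adj⁻ : Adj (G □ H) (combine a i) (combine b j) → (a ≡ b × Adj H i j) ⊎ (i ≡ j × Adj G a b)
  □-Adj⁻ = subst₂ Adj′ (remQuot-combine a i) (remQuot-combine b j)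

rung-unequalizable-from-layer :
  ∀ {G} {a b : Vertex G} {i j : Fin m} → a ≢ b →
  ¬ Equidistant (G □ K m) (combine a i) (combine b i) (combine a j)
rung-unequalizable-from-layer {m} {G} {a} {b} {i} {j} a≢b equidistant with i ≟ j
... | yes refl = off-layer (equidistant-from-self equidistant)
  where
  off-layer : combine {order G} b i ≢ combine a i
  off-layer eq = a≢b (sym (combine-injectiveˡ b i a i eq))
... | no i≢j with equidistant-from-neighbour equidistant (□-Adj⁺ {G} {K m} (inj₁ (refl , i≢j)))
...   | inj₁ eq = a≢b (sym (combine-injectiveˡ b i a j eq))
...   | inj₂ adj with □-Adj⁻ {G} {K m} adj
...     | inj₁ (b≡a , _) = a≢b (sym b≡a)
...     | inj₂ (i≡j , _) = i≢j i≡j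

rung-unequalizable : (i : Fin m) (w : Vertex (K 2 □ K m)) →
  ¬ Equidistant (K 2 □ K m) (combine {2} zero i) (combine {2} (suc zero) i) w
rung-unequalizable {m} i w (k , d₀ , d₁) with combine-surjective {2} {m} w
... | zero     , j , refl = rung-unequalizable-from-layer {G = K 2} {zero} {suc zero} (λ ()) (k , d₀ , d₁)
... | suc zero , j , refl = rung-unequalizable-from-layer {G = K 2} {suc zero} {zero} (λ ()) (k , d₁ , d₀)

equalizer-size-lower-bound : (D : Subset (2 * m)) → IsDistanceEqualizer (K 2 □ K m) D → m ≤ ∣ D ∣
equalizer-size-lower-bound {m} D equalizer with p , q , refl ← layers-surjective {m} D =
  subst (_ ≤_) (sym (∣layers∣ p q)) (covering-pair-size p q rung-meets-D)
  where
  rung-meets-D : ∀ i → i ∈ p ⊎ i ∈ q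
  rung-meets-D i with equalizer-meets-unequalizable-pair equalizer
                        (λ eq → zero≢one (combine-injectiveˡ {2} zero i (suc zero) i eq))
                        (rung-unequalizable i)
    where
    zero≢one : zero ≢ suc {1} zero
    zero≢one ()
  ... | inj₁ ∈D = inj₁ (∈-transport (lookup-layers₀ p q i) ∈D)
  ... | inj₂ ∈D = inj₂ (∈-transport (lookup-layers₁ p q i) ∈D)

hub-equalizer : Subset (2 * suc n)
hub-equalizer = layers ⁅ zero ⁆ (∁ ⁅ zero ⁆)

∣hub-equalizer∣ : ∣ hub-equalizer {n} ∣ ≡ suc n
∣hub-equalizer∣ {n} = begin
  ∣ layers centre (∁ centre) ∣      ≡⟨ ∣layers∣ centre (∁ centre) ⟩
  ∣ centre ∣ + ∣ ∁ centre ∣         ≡⟨ cong (∣ centre ∣ +_) (∣∁p∣≡n∸∣p∣ centre) ⟩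
  ∣ centre ∣ + (suc n ∸ ∣ centre ∣) ≡⟨ cong (λ k → k + (suc n ∸ k)) (∣⁅x⁆∣≡1 (zero {n})) ⟩
  suc n                             ∎
  where
  open ≡-Reasoning
  centre : Subset (suc n)
  centre = ⁅ zero ⁆

hub-equalizer-isDistanceEqualizer : IsDistanceEqualizer (K 2 □ K (suc n)) hub-equalizer
hub-equalizer-isDistanceEqualizer {n} =
  equalizer-of-universal-vertex (in-layer₀ (x∈⁅x⁆ zero)) adjacent-to-hub
  where
  in-layer₀ : ∀ {j : Fin (suc n)} → j ∈ ⁅ zero ⁆ → combine {2} zero j ∈ hub-equalizer {n}
  in-layer₀ {j} = ∈-transport (sym (lookup-layers₀ ⁅ zero ⁆ (∁ ⁅ zero ⁆) j))

  in-layer₁ : ∀ {j : Fin (suc n)} → j ∈ ∁ ⁅ zero ⁆ → combine {2} (suc zero) j ∈ hub-equalizer {n}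
  in-layer₁ {j} = ∈-transport (sym (lookup-layers₁ ⁅ zero ⁆ (∁ ⁅ zero ⁆) j))

  adjacent-to-hub : ∀ x → x ∉ hub-equalizer → Adj (K 2 □ K (suc n)) x (combine {2} zero zero)
  adjacent-to-hub x x∉D with combine-surjective {2} {suc n} x
  ... | zero , j , refl =
    □-Adj⁺ {K 2} {K (suc n)} {zero} {zero} {j} {zero} (inj₁ (refl , λ { refl → x∉D (in-layer₀ (x∈⁅x⁆ zero)) }))
  ... | suc zero , j , refl =
    □-Adj⁺ {K 2} {K (suc n)} {suc zero} {zero} {j} {zero} (inj₂ (x∈⁅y⁆⇒x≡y zero (x∉∁p⇒x∈p (x∉D ∘ in-layer₁)) , λ ()))

equidistantDimension-K₂□K : ∀ m → EquidistantDimensionIs (K 2 □ K m) m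
equidistantDimension-K₂□K zero    = ([] , (λ ()) , refl) , λ _ _ → z≤n
equidistantDimension-K₂□K (suc n) =
  (hub-equalizer , hub-equalizer-isDistanceEqualizer , ∣hub-equalizer∣) , equalizer-size-lower-bound

mainTheorem5 : (m : ℕ) → 2 ≤ m → EquidistantDimensionIs (K 2 □ K m) m
mainTheorem5 m _ = equidistantDimension-K₂□K m
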